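{- Let $\Gamma$ be a strictly Deza graph with parameters $(n,k,b,a)$ such that $k=b+1$ and $\beta(\Gamma)>1$. If $v$ is a vertex of type (B) or (C), then $B[u]\subseteq N(v)\setminus B(v)$ for every $u\in N(v)\setminus B(v)$.
   Context: Graphs are finite, simple, undirected. $N(v)$ is the neighbourhood of $v$. A Deza graph with parameters $(n,k,b,a)$, $b\ge a$, is a nonempty $k$-regular graph on $n$ vertices in which every pair of distinct vertices has exactly $b$ or exactly $a$ common neighbours; it is strictly Deza if it has diameter $2$ and is not strongly regular. $B(v)=\{u: |N(u)\cap N(v)|=b\}$, $B[v]=B(v)\cup\{v\}$; $\beta(\Gamma)=|B(v)|$ (independent of $v$). A vertex $v$ is of type (B) if $B(v)\subset N(v)$, and of type (C) if $|B(v)\cap N(v)|=1$. -}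

module Defs where

open import Data.Nat using (ℕ; zero; suc; _+_; _<_; _≤_; _≥_)
open import Data.Nat.Properties using ()
open import Data.Bool using (Bool; true; false; _∧_; if_then_else_; not)
open import Data.Fin using (Fin; _≟_)
open import Data.List using (List; map; allFin)
open import Data.Nat.ListAction using (sum)
open import Data.Product using (Σ; ∃; ∃-syntax; _×_; _,_)
open import Data.Sum using (_⊎_)
open import Relation.Nullary using (¬_)
open import Relation.Nullary.Decidable using (isYes)
open import Relation.Binary.PropositionalEquality using (_≡_; _≢_)

record Graph (n : ℕ) : Set where
  field
    adj      : Fin n → Fin n → Bool
    symmetric  : ∀ u v → adj u v ≡ adj v u
    irreflexive : ∀ v → adj v v ≡ false

open Graph public

_~[_]_ : {n : ℕ} → Fin n → Graph n → Fin n → Set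
u ~[ G ] v = adj G u v ≡ true

countᵇ : {n : ℕ} → (Fin n → Bool) → ℕ
countᵇ {n} p = sum (map (λ i → if p i then 1 else 0) (allFin n))

degree : {n : ℕ} → Graph n → Fin n → ℕ
degree G v = countᵇ (λ w → adj G v w)

commonNbrs : {n : ℕ} → Graph n → Fin n → Fin n → ℕ
commonNbrs G u v = countᵇ (λ w → adj G u w ∧ adj G v w)

Regular : {n : ℕ} → Graph n → ℕ → Set
Regular G k = ∀ v → degree G v ≡ k

IsDeza : {n : ℕ} → Graph n → ℕ → ℕ → ℕ → Set
IsDeza {n} G k b a =
  (b ≥ a) × (0 < n) × Regular G k ×
  (∀ u v → u ≢ v → (commonNbrs G u v ≡ b) ⊎ (commonNbrs G u v ≡ a))

HasDiameter2 : {n : ℕ} → Graph n → Set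
HasDiameter2 G =
  (∀ u v → u ≢ v → (u ~[ G ] v) ⊎ (∃[ w ] ((u ~[ G ] w) × (w ~[ G ] v))))
  × (∃[ u ] ∃[ v ] ((u ≢ v) × ¬ (u ~[ G ] v)))

IsStronglyRegular : {n : ℕ} → Graph n → Set
IsStronglyRegular G =
  ∃[ k ] ∃[ l ] ∃[ m ] (Regular G k ×
    (∀ u v → u ~[ G ] v → commonNbrs G u v ≡ l) ×
    (∀ u v → u ≢ v → ¬ (u ~[ G ] v) → commonNbrs G u v ≡ m))

IsStrictlyDeza : {n : ℕ} → Graph n → ℕ → ℕ → ℕ → Set
IsStrictlyDeza G k b a = IsDeza G k b a × HasDiameter2 G × ¬ IsStronglyRegular G

InB : {n : ℕ} → Graph n → ℕ → Fin n → Fin n → Set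
InB G b v u = (u ≢ v) × (commonNbrs G u v ≡ b)

InB[] : {n : ℕ} → Graph n → ℕ → Fin n → Fin n → Set
InB[] G b v u = (u ≡ v) ⊎ InB G b v u

inBᵇ : {n : ℕ} → Graph n → ℕ → Fin n → Fin n → Bool
inBᵇ G b v u = not (isYes (u ≟ v)) ∧ isYes (commonNbrs G u v Data.Nat.≟ b)

sizeB : {n : ℕ} → Graph n → ℕ → Fin n → ℕ
sizeB G b v = countᵇ (inBᵇ G b v)

TypeB : {n : ℕ} → Graph n → ℕ → Fin n → Set
TypeB G b v = ∀ u → InB G b v u → v ~[ G ] u

TypeC : {n : ℕ} → Graph n → ℕ → Fin n → Set
TypeC G b v = countᵇ (λ u → inBᵇ G b v u ∧ adj G v u) ≡ 1

module Submission where

-- Since k = b + 1, y ∈ B(x) means that x has exactly one neighbour outside N(y); if also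
-- x ~ y, that neighbour is y itself, i.e. N(x) ∖ {y} ⊆ N(y), and conversely this inclusion
-- (for adjacent x, y) forces y ∈ B(x).
-- Types (B) and (C) with β > 1 provide some t ∈ B(v) adjacent to v, hence also to u.
-- Let u ∈ N(v) ∖ B(v) and w ∈ B(u). If u ~ w, the inclusion for (u, w) gives v ~ w, and
-- v ∈ B(w) would chain the inclusions for (u, w) and (w, v) into one for (u, v), putting
-- u ∈ B(v). If u ≁ w, then v ≁ w would make v and t two neighbours of u outside N(w);
-- so v ~ w, and then v ∈ B(w) would give w ~ u by the inclusion for (v, w).

open import Defs
open import Data.Nat using (ℕ; zero; suc; _+_; _<_) renaming (_≟_ to _≟ⁿ_)
open import Data.Nat.Properties
  using (+-comm; +-cancelˡ-≡; +-cancelʳ-≡; m+n≡0⇒m≡0; m+n≡0⇒n≡0; <⇒≢; <-trans; 0<1+n;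
         suc-injective; +-commutativeSemigroup)
open import Algebra.Properties.CommutativeSemigroup +-commutativeSemigroup using (interchange)
open import Data.Fin using (Fin; zero; suc)
open import Data.Fin.Properties using (0≢1+n; any?)
  renaming (suc-injective to Fin-suc-injective; _≟_ to _≟ᶠ_)
open import Data.Bool using (Bool; true; false; _∧_; not; if_then_else_)
open import Data.Bool.Properties using (∧-comm; ∧-conicalˡ; ∧-conicalʳ; ¬-not)
  renaming (_≟_ to _≟ᵇ_)
open import Data.List using (map; allFin)
open import Data.List.Properties using (map-tabulate; map-cong)
open import Data.Nat.ListAction using (sum)
open import Data.Product using (_×_; ∃-syntax; _,_; proj₁; proj₂)
open import Data.Sum using (_⊎_; inj₁; inj₂)
open import Function using (_∘_; id)
open import Relation.Nullary using (¬_; yes; no; contradiction)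
open import Relation.Binary.PropositionalEquality
  using (_≡_; _≢_; refl; sym; trans; cong; cong₂; subst; module ≡-Reasoning)

indicator : Bool → ℕ
indicator x = if x then 1 else 0

countᵇ-cong : ∀ {n} {p q : Fin n → Bool} → (∀ i → p i ≡ q i) → countᵇ p ≡ countᵇ q
countᵇ-cong {n} p≗q = cong sum (map-cong (cong indicator ∘ p≗q) (allFin n))

countᵇ-suc : ∀ {n} (p : Fin (suc n) → Bool) →
             countᵇ p ≡ indicator (p zero) + countᵇ (p ∘ suc)
countᵇ-suc p = cong (indicator (p zero) +_) (cong sum
  (trans (map-tabulate suc f) (sym (map-tabulate id (f ∘ suc)))))
  where f = indicator ∘ p

countᵇ-suc-true : ∀ {n} (p : Fin (suc n) → Bool) → p zero ≡ true →
                  countᵇ p ≡ suc (countᵇ (p ∘ suc))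
countᵇ-suc-true p p0 = trans (countᵇ-suc p) (cong (λ x → indicator x + countᵇ (p ∘ suc)) p0)

countᵇ-suc-false : ∀ {n} (p : Fin (suc n) → Bool) → p zero ≡ false →
                   countᵇ p ≡ countᵇ (p ∘ suc)
countᵇ-suc-false p p0 = trans (countᵇ-suc p) (cong (λ x → indicator x + countᵇ (p ∘ suc)) p0)

indicator-partition : ∀ x y → indicator x ≡ indicator (x ∧ y) + indicator (x ∧ not y)
indicator-partition true  true  = refl
indicator-partition true  false = refl
indicator-partition false _     = refl

countᵇ-partition : ∀ {n} (p q : Fin n → Bool) →
  countᵇ p ≡ countᵇ (λ i → p i ∧ q i) + countᵇ (λ i → p i ∧ not (q i))
countᵇ-partition {zero}  p q = refl
countᵇ-partition {suc n} p q = begin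
  countᵇ p
    ≡⟨ countᵇ-suc p ⟩
  indicator (p zero) + countᵇ (p ∘ suc)
    ≡⟨ cong₂ _+_ (indicator-partition (p zero) (q zero))
                 (countᵇ-partition (p ∘ suc) (q ∘ suc)) ⟩
  (indicator (p∧q zero) + indicator (p∧¬q zero)) + (countᵇ (p∧q ∘ suc) + countᵇ (p∧¬q ∘ suc))
    ≡⟨ interchange (indicator (p∧q zero)) (indicator (p∧¬q zero))
                   (countᵇ (p∧q ∘ suc)) (countᵇ (p∧¬q ∘ suc)) ⟩
  (indicator (p∧q zero) + countᵇ (p∧q ∘ suc)) + (indicator (p∧¬q zero) + countᵇ (p∧¬q ∘ suc))
    ≡⟨ sym (cong₂ _+_ (countᵇ-suc p∧q) (countᵇ-suc p∧¬q)) ⟩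
  countᵇ p∧q + countᵇ p∧¬q ∎
  where
  open ≡-Reasoning
  p∧q p∧¬q : Fin (suc n) → Bool
  p∧q i = p i ∧ q i
  p∧¬q i = p i ∧ not (q i)

countᵇ≡0⇒all-false : ∀ {n} (p : Fin n → Bool) → countᵇ p ≡ 0 → ∀ i → p i ≡ false
countᵇ≡0⇒all-false {suc n} p c = all-false
  where
  c′ : indicator (p zero) + countᵇ (p ∘ suc) ≡ 0
  c′ = trans (sym (countᵇ-suc p)) c
  all-false : ∀ i → p i ≡ false
  all-false zero    with p zero | m+n≡0⇒m≡0 (indicator (p zero)) c′
  ... | false | _  = refl
  ... | true  | ()
  all-false (suc i) = countᵇ≡0⇒all-false (p ∘ suc) (m+n≡0⇒n≡0 (indicator (p zero)) c′) i

all-false⇒countᵇ≡0 : ∀ {n} (p : Fin n → Bool) → (∀ i → p i ≡ false) → countᵇ p ≡ 0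
all-false⇒countᵇ≡0 {zero}  p none = refl
all-false⇒countᵇ≡0 {suc n} p none =
  trans (countᵇ-suc-false p (none zero)) (all-false⇒countᵇ≡0 (p ∘ suc) (none ∘ suc))

countᵇ>0⇒∃ : ∀ {n} (p : Fin n → Bool) → 0 < countᵇ p → ∃[ i ] p i ≡ true
countᵇ>0⇒∃ p c with any? (λ i → p i ≟ᵇ true)
... | yes found = found
... | no  ¬found = contradiction
  (sym (all-false⇒countᵇ≡0 p (λ i → ¬-not (λ pi → ¬found (i , pi))))) (<⇒≢ c)

countᵇ≡1⇒tail-false : ∀ {n} (p : Fin (suc n) → Bool) → countᵇ p ≡ 1 → p zero ≡ true →
                ∀ i → p (suc i) ≡ false
countᵇ≡1⇒tail-false p c p0 =
  countᵇ≡0⇒all-false (p ∘ suc) (suc-injective (trans (sym (countᵇ-suc-true p p0)) c))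

countᵇ≡1⇒unique : ∀ {n} (p : Fin n → Bool) → countᵇ p ≡ 1 →
                  ∀ {i j} → p i ≡ true → p j ≡ true → i ≡ j
countᵇ≡1⇒unique {suc n} p c {zero}  {zero}  _  _  = refl
countᵇ≡1⇒unique {suc n} p c {zero}  {suc j} p0 pj =
  contradiction (trans (sym pj) (countᵇ≡1⇒tail-false p c p0 j)) λ ()
countᵇ≡1⇒unique {suc n} p c {suc i} {zero}  pi p0 =
  contradiction (trans (sym pi) (countᵇ≡1⇒tail-false p c p0 i)) λ ()
countᵇ≡1⇒unique {suc n} p c {suc i} {suc j} pi pj with p zero ≟ᵇ true
... | yes p0 = contradiction (trans (sym pi) (countᵇ≡1⇒tail-false p c p0 i)) λ ()
... | no ¬p0 = cong suc
  (countᵇ≡1⇒unique (p ∘ suc) (trans (sym (countᵇ-suc-false p (¬-not ¬p0))) c) pi pj)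

countᵇ-unique⇒≡1 : ∀ {n} (p : Fin n → Bool) {y} → p y ≡ true →
                   (∀ z → p z ≡ true → z ≡ y) → countᵇ p ≡ 1
countᵇ-unique⇒≡1 {suc n} p {zero} p0 only = trans (countᵇ-suc-true p p0)
  (cong suc (all-false⇒countᵇ≡0 (p ∘ suc)
    (λ i → ¬-not (λ pi → 0≢1+n (sym (only (suc i) pi))))))
countᵇ-unique⇒≡1 {suc n} p {suc y} py only = trans
  (countᵇ-suc-false p (¬-not (λ p0 → 0≢1+n (only zero p0))))
  (countᵇ-unique⇒≡1 (p ∘ suc) py (λ z pz → Fin-suc-injective (only (suc z) pz)))

module _ {n : ℕ} (G : Graph n) where

  ~-sym : ∀ {x y} → x ~[ G ] y → y ~[ G ] x
  ~-sym {x} {y} x~y = trans (symmetric G y x) x~y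

  ~⇒≢ : ∀ {x y} → x ~[ G ] y → x ≢ y
  ~⇒≢ {x} x~x refl = contradiction (trans (sym x~x) (irreflexive G x)) λ ()

  commonNbrs-sym : ∀ x y → commonNbrs G x y ≡ commonNbrs G y x
  commonNbrs-sym x y = countᵇ-cong (λ z → ∧-comm (adj G x z) (adj G y z))

  privateNbrᵇ : Fin n → Fin n → Fin n → Bool
  privateNbrᵇ x y z = adj G x z ∧ not (adj G y z)

  privateNbr-intro : ∀ {x y z} → x ~[ G ] z → adj G y z ≡ false → privateNbrᵇ x y z ≡ true
  privateNbr-intro x~z y≁z = cong₂ (λ xz yz → xz ∧ not yz) x~z y≁z

  degree≡commonNbrs+privateNbrs : ∀ x y →
    degree G x ≡ commonNbrs G x y + countᵇ (privateNbrᵇ x y)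
  degree≡commonNbrs+privateNbrs x y = countᵇ-partition (adj G x) (adj G y)

  NbrsShared : Fin n → Fin n → Set
  NbrsShared x y = ∀ z → x ~[ G ] z → z ≢ y → y ~[ G ] z

module _ {n : ℕ} (G : Graph n) {b : ℕ} (regular : Regular G (suc b)) where

  commonNbrs+privateNbrs≡b+1 : ∀ x y →
    commonNbrs G x y + countᵇ (privateNbrᵇ G x y) ≡ b + 1
  commonNbrs+privateNbrs≡b+1 x y =
    trans (sym (degree≡commonNbrs+privateNbrs G x y)) (trans (regular x) (+-comm 1 b))

  commonNbrs≡b⇒privateNbrs≡1 : ∀ {x y} → commonNbrs G x y ≡ b →
                               countᵇ (privateNbrᵇ G x y) ≡ 1
  commonNbrs≡b⇒privateNbrs≡1 {x} {y} cn≡b = +-cancelˡ-≡ b _ _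
    (trans (cong (_+ countᵇ (privateNbrᵇ G x y)) (sym cn≡b))
           (commonNbrs+privateNbrs≡b+1 x y))

  privateNbrs≡1⇒commonNbrs≡b : ∀ {x y} → countᵇ (privateNbrᵇ G x y) ≡ 1 →
                               commonNbrs G x y ≡ b
  privateNbrs≡1⇒commonNbrs≡b {x} {y} one = +-cancelʳ-≡ 1 _ _
    (trans (cong (commonNbrs G x y +_) (sym one)) (commonNbrs+privateNbrs≡b+1 x y))

  privateNbr-unique : ∀ {x y z z′} → commonNbrs G x y ≡ b →
    x ~[ G ] z → adj G y z ≡ false → x ~[ G ] z′ → adj G y z′ ≡ false → z ≡ z′
  privateNbr-unique cn≡b x~z y≁z x~z′ y≁z′ =
    countᵇ≡1⇒unique _ (commonNbrs≡b⇒privateNbrs≡1 cn≡b)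
      (privateNbr-intro G x~z y≁z) (privateNbr-intro G x~z′ y≁z′)

  commonNbrs≡b⇒NbrsShared : ∀ {x y} → x ~[ G ] y → commonNbrs G x y ≡ b → NbrsShared G x y
  commonNbrs≡b⇒NbrsShared {x} {y} x~y cn≡b z x~z z≢y with adj G y z in y?z
  ... | true  = refl
  ... | false = contradiction (privateNbr-unique cn≡b x~z y?z x~y (irreflexive G y)) z≢y

  NbrsShared⇒commonNbrs≡b : ∀ {x y} → x ~[ G ] y → NbrsShared G x y → commonNbrs G x y ≡ b
  NbrsShared⇒commonNbrs≡b {x} {y} x~y shared = privateNbrs≡1⇒commonNbrs≡b
    (countᵇ-unique⇒≡1 _ (privateNbr-intro G x~y (irreflexive G y)) onlyY)
    where
    onlyY : ∀ z → privateNbrᵇ G x y z ≡ true → z ≡ y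
    onlyY z z-private with z ≟ᶠ y
    ... | yes z≡y = z≡y
    ... | no  z≢y = contradiction
      (subst (λ yz → not yz ≡ true) (shared z (∧-conicalˡ _ _ z-private) z≢y)
             (∧-conicalʳ _ _ z-private))
      λ ()

  module _ {v u w : Fin n} (v~u : v ~[ G ] u) (u∉Bv : ¬ InB G b v u) (w∈Bu : InB G b u w) where

    private
      u~v : u ~[ G ] v
      u~v = ~-sym G v~u

      commonNbrs-uw≡b : commonNbrs G u w ≡ b
      commonNbrs-uw≡b = trans (commonNbrs-sym G u w) (proj₂ w∈Bu)

      commonNbrs-uv≢b : commonNbrs G u v ≢ b
      commonNbrs-uv≢b cn≡b = u∉Bv (~⇒≢ G u~v , cn≡b)

      v≢w : v ≢ w
      v≢w refl = commonNbrs-uv≢b commonNbrs-uw≡b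

    B-of-nbr-outside-B⇒adjacent : ∀ {t} → v ~[ G ] t → InB G b v t → v ~[ G ] w
    B-of-nbr-outside-B⇒adjacent {t} v~t (t≢v , commonNbrs-tv≡b) with adj G u w in u?w
    ... | true  = ~-sym G (commonNbrs≡b⇒NbrsShared u?w commonNbrs-uw≡b v u~v v≢w)
    ... | false with adj G v w in v?w
    ...   | true  = refl
    ...   | false = contradiction (privateNbr-unique commonNbrs-uw≡b u~t w≁t u~v w≁v) t≢v
      where
      w≁v : adj G w v ≡ false
      w≁v = trans (symmetric G w v) v?w
      u≢t : u ≢ t
      u≢t refl = commonNbrs-uv≢b commonNbrs-tv≡b
      u~t : u ~[ G ] t
      u~t = ~-sym G (commonNbrs≡b⇒NbrsShared v~t
                       (trans (commonNbrs-sym G v t) commonNbrs-tv≡b) u v~u u≢t)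
      w≁t : adj G w t ≡ false
      w≁t with adj G w t in w?t
      ... | false = refl
      ... | true  = contradiction (trans (sym v~w) v?w) λ ()
        where
        v~w : v ~[ G ] w
        v~w = commonNbrs≡b⇒NbrsShared (~-sym G v~t) commonNbrs-tv≡b w (~-sym G w?t) (v≢w ∘ sym)

    B-of-nbr-outside-B⇒∉B : v ~[ G ] w → ¬ InB G b v w
    B-of-nbr-outside-B⇒∉B v~w (w≢v , commonNbrs-wv≡b) with adj G u w in u?w
    ... | true  = commonNbrs-uv≢b (NbrsShared⇒commonNbrs≡b u~v shared)
      where
      shared : NbrsShared G u v
      shared z u~z z≢v with z ≟ᶠ w
      ... | yes refl = v~w
      ... | no  z≢w  = commonNbrs≡b⇒NbrsShared (~-sym G v~w) commonNbrs-wv≡b z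
                         (commonNbrs≡b⇒NbrsShared u?w commonNbrs-uw≡b z u~z z≢w) z≢v
    ... | false = contradiction (trans (sym w~u) u?w) λ ()
      where
      w~u : u ~[ G ] w
      w~u = ~-sym G (commonNbrs≡b⇒NbrsShared v~w
                       (trans (commonNbrs-sym G v w) commonNbrs-wv≡b) u v~u (proj₁ w∈Bu ∘ sym))

module _ {n : ℕ} (G : Graph n) (b : ℕ) where

  inBᵇ-sound : ∀ {v u} → inBᵇ G b v u ≡ true → InB G b v u
  inBᵇ-sound {v} {u} e with u ≟ᶠ v | commonNbrs G u v ≟ⁿ b
  ... | no u≢v | yes cn≡b = u≢v , cn≡b
  ... | yes _  | _        = contradiction e λ ()
  ... | no _   | no _     = contradiction e λ ()

  ∃-adjacent-InB : ∀ {v} → TypeB G b v ⊎ TypeC G b v → 1 < sizeB G b v →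
                 ∃[ t ] (v ~[ G ] t × InB G b v t)
  ∃-adjacent-InB (inj₁ typeB) 1<β with countᵇ>0⇒∃ (inBᵇ G b _) (<-trans 0<1+n 1<β)
  ... | t , t∈Bv = t , typeB t (inBᵇ-sound t∈Bv) , inBᵇ-sound t∈Bv
  ∃-adjacent-InB (inj₂ typeC) _ with countᵇ>0⇒∃ _ (subst (0 <_) (sym typeC) 0<1+n)
  ... | t , t∈Bv∩Nv = t , ∧-conicalʳ _ _ t∈Bv∩Nv , inBᵇ-sound (∧-conicalˡ _ _ t∈Bv∩Nv)

lemma14 : {n : ℕ} (G : Graph n) (k b a : ℕ) →
    IsStrictlyDeza G k b a →
    k ≡ suc b →
    (∀ w → 1 < sizeB G b w) →
    (v : Fin n) → (TypeB G b v ⊎ TypeC G b v) →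
    (u : Fin n) → (v ~[ G ] u) → ¬ InB G b v u →
    (w : Fin n) → InB[] G b u w → (v ~[ G ] w) × ¬ InB G b v w
lemma14 G k b a _ _ _ v _ u v~u u∉Bv .u (inj₁ refl) = v~u , u∉Bv
lemma14 G k b a ((_ , _ , regular , _) , _) refl 1<β v typeBC u v~u u∉Bv w (inj₂ w∈Bu) =
  v~w , B-of-nbr-outside-B⇒∉B G regular v~u u∉Bv w∈Bu v~w
  where
  v~w : v ~[ G ] w
  v~w with ∃-adjacent-InB G b typeBC (1<β v)
  ... | t , v~t , t∈Bv = B-of-nbr-outside-B⇒adjacent G regular v~u u∉Bv w∈Bu v~t t∈Bv
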